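{- Let $G$ be a transitive acyclic digraph. Then $\chi_o(G)\leq \Delta(G)+1$.
   Context: A digraph $G=(V,E)$ (no loops) is acyclic if it contains no directed cycle of any length $\ge 2$, and transitive if $(u,v),(v,w)\in E$, $u\neq w$ imply $(u,w)\in E$. $\Delta(G)=\max_{v\in V}(\mathrm{indegree}(v)+\mathrm{outdegree}(v))$. An oriented $r$-coloring of an oriented graph $G=(V,E)$ is a map $c:V\to\{1,\dots,r\}$ with $c(u)\neq c(v)$ for every $(u,v)\in E$, and $c(u)\neq c(y)$ for every two arcs $(u,v),(x,y)\in E$ with $c(v)=c(x)$; $\chi_o(G)$ is the smallest such $r$. -}

module Defs where
open import Data.Nat using (ℕ; zero; suc; _+_; _⊔_; _≤_)
open import Data.Bool using (Bool; true; false; if_then_else_)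
open import Data.Fin using (Fin)
open import Data.List using (List; allFin; map; foldr)
open import Data.Nat.ListAction using (sum)
open import Relation.Binary.PropositionalEquality using (_≡_; _≢_)
open import Relation.Binary.Construct.Closure.Transitive using (TransClosure)
open import Relation.Nullary using (¬_)
open import Data.Product using (Σ; _×_)

record Digraph : Set where
  field
    n        : ℕ
    arc      : Fin n → Fin n → Bool
    loopless : ∀ v → arc v v ≡ false

open Digraph public

Arc : (G : Digraph) → Fin (n G) → Fin (n G) → Set
Arc G u v = arc G u v ≡ true

-- acyclic: no directed closed walk of length ≥ 1 (equivalently, since G is
-- loopless, no directed cycle of length ≥ 2)
Acyclic : Digraph → Set
Acyclic G = ∀ v → ¬ TransClosure (Arc G) v v

Transitive : Digraph → Set
Transitive G = ∀ u v w → Arc G u v → Arc G v w → u ≢ w → Arc G u w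

indicator : Bool → ℕ
indicator b = if b then 1 else 0

outdegree : (G : Digraph) → Fin (n G) → ℕ
outdegree G v = sum (map (λ w → indicator (arc G v w)) (allFin (n G)))

indegree : (G : Digraph) → Fin (n G) → ℕ
indegree G v = sum (map (λ w → indicator (arc G w v)) (allFin (n G)))

degree : (G : Digraph) → Fin (n G) → ℕ
degree G v = indegree G v + outdegree G v

Δ : Digraph → ℕ
Δ G = foldr _⊔_ 0 (map (degree G) (allFin (n G)))

IsOrientedColoring : (G : Digraph) (r : ℕ) → (Fin (n G) → Fin r) → Set
IsOrientedColoring G r c =
  (∀ u v → Arc G u v → c u ≢ c v) ×
  (∀ u v x y → Arc G u v → Arc G x y → c v ≡ c x → c u ≢ c y)

HasOrientedColoring : Digraph → ℕ → Set
HasOrientedColoring G r = Σ (Fin (n G) → Fin r) (IsOrientedColoring G r)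

IsOrientedChromaticNumber : Digraph → ℕ → Set
IsOrientedChromaticNumber G k =
  HasOrientedColoring G k × (∀ r → HasOrientedColoring G r → k ≤ r)

-- In a transitive acyclic digraph the in-degree strictly increases along every arc u → v:
-- each in-neighbour w of u is an in-neighbour of v (transitivity, with w ≠ v by acyclicity),
-- and u itself is a new in-neighbour of v. Colouring each vertex by its in-degree, a value in
-- 0 … Δ, is then an oriented colouring: for arcs u → v and x → y with v, x of equal colour,
-- indeg u < indeg v = indeg x < indeg y, so u and y get different colours. Since having an
-- oriented r-colouring is decidable, a least such r exists and is at most Δ + 1.
module Submission where

open import Defs
open import Data.Bool using (true; false)
import Data.Bool as Bool
open import Data.Fin using (Fin; toℕ; fromℕ<; finToFun; funToFin)
open import Data.Fin.Properties using (toℕ-fromℕ<; finToFun-funToFin; any?; all?)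
import Data.Fin.Properties as Fin
open import Data.List using ([]; _∷_; map; foldr)
open import Data.List.Membership.Propositional using (_∈_)
open import Data.List.Membership.Propositional.Properties using (∈-allFin; ∈-map⁺)
open import Data.List.Relation.Unary.Any using (here; there)
open import Data.Nat using (ℕ; suc; _≤_; _<_; _⊔_; z≤n; s≤s)
open import Data.Nat.Induction using (<-wellFounded)
open import Data.Nat.ListAction using (sum)
open import Data.Nat.Properties
  using (≤-refl; ≤-trans; <⇒≢; ≮⇒≥; m≤m⊔n; m≤n⊔m; m≤m+n; +-mono-≤; +-mono-<-≤; +-mono-≤-<; anyUpTo?; module ≤-Reasoning)
open import Data.Product using (∃; _×_; _,_)
open import Function using (_∘_)
open import Induction.WellFounded using (Acc; acc)
open import Level using (0ℓ)
open import Relation.Binary.Construct.Closure.Transitive using ([_]; _∷_)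
open import Relation.Binary.PropositionalEquality using (_≡_; _≢_; refl; sym; trans; cong; subst₂; _≗_)
open import Relation.Nullary using (Dec; yes; no)
open import Relation.Nullary.Decidable using (map′; _×-dec_; _→-dec_; ¬?)
open import Relation.Unary using (Pred; Decidable)

module _ {A : Set} (f g : A → ℕ) where

  sum-map-mono-≤ : ∀ xs → (∀ x → f x ≤ g x) → sum (map f xs) ≤ sum (map g xs)
  sum-map-mono-≤ []       f≤g = z≤n
  sum-map-mono-≤ (x ∷ xs) f≤g = +-mono-≤ (f≤g x) (sum-map-mono-≤ xs f≤g)

  sum-map-mono-< : ∀ {xs y} → (∀ x → f x ≤ g x) → y ∈ xs → f y < g y →
                   sum (map f xs) < sum (map g xs)
  sum-map-mono-< {x ∷ xs} f≤g (here refl) fy<gy = +-mono-<-≤ fy<gy (sum-map-mono-≤ xs f≤g)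
  sum-map-mono-< {x ∷ xs} f≤g (there y∈) fy<gy = +-mono-≤-< (f≤g x) (sum-map-mono-< f≤g y∈ fy<gy)

∈⇒≤-foldr-⊔ : ∀ {x xs} → x ∈ xs → x ≤ foldr _⊔_ 0 xs
∈⇒≤-foldr-⊔ {xs = y ∷ ys} (here refl) = m≤m⊔n y _
∈⇒≤-foldr-⊔ {xs = y ∷ ys} (there x∈) = ≤-trans (∈⇒≤-foldr-⊔ x∈) (m≤n⊔m y _)

indicator-mono : ∀ {a b} → (a ≡ true → b ≡ true) → indicator a ≤ indicator b
indicator-mono {false} a⇒b = z≤n
indicator-mono {true}  a⇒b with a⇒b refl
... | refl = ≤-refl

indegree≤Δ : (G : Digraph) (v : Fin (n G)) → indegree G v ≤ Δ G
indegree≤Δ G v = ≤-trans (m≤m+n _ _) (∈⇒≤-foldr-⊔ (∈-map⁺ (degree G) (∈-allFin v)))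

module _ (G : Digraph) where

  increasing⇒isOrientedColoring : ∀ {r} (c : Fin (n G) → Fin r) →
    (∀ {u v} → Arc G u v → toℕ (c u) < toℕ (c v)) → IsOrientedColoring G r c
  increasing⇒isOrientedColoring c increasing = proper , oriented
    where
    proper : ∀ u v → Arc G u v → c u ≢ c v
    proper u v uv = <⇒≢ (increasing uv) ∘ cong toℕ

    oriented : ∀ u v x y → Arc G u v → Arc G x y → c v ≡ c x → c u ≢ c y
    oriented u v x y uv xy cv≡cx = <⇒≢ cu<cy ∘ cong toℕ
      where
      open ≤-Reasoning
      cu<cy : toℕ (c u) < toℕ (c y)
      cu<cy = begin-strict
        toℕ (c u) <⟨ increasing uv ⟩
        toℕ (c v) ≡⟨ cong toℕ cv≡cx ⟩
        toℕ (c x) <⟨ increasing xy ⟩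
        toℕ (c y) ∎

  module _ (transitive : Transitive G) (acyclic : Acyclic G) where

    inNeighbour-along-arc : ∀ {u v w} → Arc G u v → Arc G w u → Arc G w v
    inNeighbour-along-arc {u} {v} {w} uv wu = transitive w u v wu uv w≢v
      where
      w≢v : w ≢ v
      w≢v refl = acyclic w (wu ∷ [ uv ])

    indegree-increasing : ∀ {u v} → Arc G u v → indegree G u < indegree G v
    indegree-increasing {u} {v} uv =
      sum-map-mono-< _ _ (λ w → indicator-mono (inNeighbour-along-arc uv)) (∈-allFin u) u-new
      where
      u-new : indicator (arc G u u) < indicator (arc G u v)
      u-new rewrite loopless G u | uv = s≤s z≤n

    indegreeColouring : Fin (n G) → Fin (suc (Δ G))
    indegreeColouring v = fromℕ< (s≤s (indegree≤Δ G v))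

    indegreeColouring-isOrientedColoring : IsOrientedColoring G (suc (Δ G)) indegreeColouring
    indegreeColouring-isOrientedColoring =
      increasing⇒isOrientedColoring indegreeColouring λ uv →
        subst₂ _<_ (sym (toℕ-fromℕ< _)) (sym (toℕ-fromℕ< _)) (indegree-increasing uv)

isOrientedColoring? : (G : Digraph) (r : ℕ) → Decidable (IsOrientedColoring G r)
isOrientedColoring? G r c =
  all? (λ u → all? (λ v → arc? u v →-dec ¬? (c u Fin.≟ c v)))
  ×-dec
  all? (λ u → all? (λ v → all? (λ x → all? (λ y →
    arc? u v →-dec (arc? x y →-dec ((c v Fin.≟ c x) →-dec ¬? (c u Fin.≟ c y)))))))
  where
  arc? : ∀ u v → Dec (Arc G u v)
  arc? u v = arc G u v Bool.≟ true

isOrientedColoring-resp-≗ : (G : Digraph) (r : ℕ) {c d : Fin (n G) → Fin r} → c ≗ d →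
  IsOrientedColoring G r c → IsOrientedColoring G r d
isOrientedColoring-resp-≗ G r {c} {d} c≗d (proper , oriented) =
  (λ u v uv du≡dv → proper u v uv (transport u v du≡dv)) ,
  (λ u v x y uv xy dv≡dx du≡dy →
     oriented u v x y uv xy (transport v x dv≡dx) (transport u y du≡dy))
  where
  transport : ∀ u v → d u ≡ d v → c u ≡ c v
  transport u v du≡dv = trans (c≗d u) (trans du≡dv (sym (c≗d v)))

-- The colourings Fin n → Fin r are enumerated by Fin (r ^ n) via finToFun.
hasOrientedColoring? : (G : Digraph) (r : ℕ) → Dec (HasOrientedColoring G r)
hasOrientedColoring? G r =
  map′ (λ (i , col) → finToFun i , col)
       (λ (c , col) → funToFin c , isOrientedColoring-resp-≗ G r (sym ∘ finToFun-funToFin c) col)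
       (any? (isOrientedColoring? G r ∘ finToFun))

module _ {P : Pred ℕ 0ℓ} (P? : Decidable P) where

  least-acc : ∀ {m} → Acc _<_ m → P m → ∃ λ k → P k × (∀ r → P r → k ≤ r)
  least-acc {m} (acc below) pm with anyUpTo? P? m
  ... | yes (r , r<m , pr) = least-acc (below r<m) pr
  ... | no none            = m , pm , λ r pr → ≮⇒≥ (λ r<m → none (r , r<m , pr))

  least : ∀ {m} → P m → ∃ λ k → P k × (∀ r → P r → k ≤ r)
  least = least-acc (<-wellFounded _)

corollary3p4 : (G : Digraph) → Transitive G → Acyclic G →
    ∃ λ k → IsOrientedChromaticNumber G k × k ≤ suc (Δ G)
corollary3p4 G transitive acyclic =
  let k , coloured , minimal = least (hasOrientedColoring? G) Δ+1-colouring
  in  k , (coloured , minimal) , minimal _ Δ+1-colouring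
  where
  Δ+1-colouring : HasOrientedColoring G (suc (Δ G))
  Δ+1-colouring = indegreeColouring G transitive acyclic
                , indegreeColouring-isOrientedColoring G transitive acyclic
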